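{- Let $q=2^m$ for a positive integer $m$, and let $f(x)=x^e$ be a polynomial over $\mathrm{GF}(q)$ such that $\gcd(e(e-1),q-1)=1$. Then $f$ is a d-polynomial over $\mathrm{GF}(q)$.
   Context: A d-polynomial (design polynomial) over $\mathrm{GF}(q)$ is a permutation polynomial $f$ of $\mathrm{GF}(q)$ such that the size $|\{f(x)+bx: x\in\mathrm{GF}(q)\}|$ is the same for all $b\in\mathrm{GF}(q)^*$. -}

module Defs where

open import Level using (0ℓ)
open import Data.Nat using (ℕ; zero; suc)
open import Data.Fin using (Fin)
open import Data.Fin.Properties using (any?) renaming (_≟_ to _≟ᶠ_)
open import Data.List using (List; filter; length; allFin)
open import Data.Product using (∃; _,_; _×_)
open import Relation.Binary.PropositionalEquality using (_≡_; _≢_)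
open import Algebra.Structures using (IsCommutativeRing)
open import Function.Bundles using (_↔_; Inverse)
open import Function.Definitions using (Bijective)

-- Since finite fields of a given order are unique up to isomorphism,
-- quantifying over all such records is quantifying over GF(q).
record FiniteField (q : ℕ) : Set₁ where
  infixl 6 _+_
  infixl 7 _*_
  field
    Carrier : Set
    _+_ _*_ : Carrier → Carrier → Carrier
    -_ : Carrier → Carrier
    0# 1# : Carrier
    isCommutativeRing : IsCommutativeRing _≡_ _+_ _*_ -_ 0# 1#
    0≢1 : 0# ≢ 1#
    hasInverse : ∀ x → x ≢ 0# → ∃ λ y → x * y ≡ 1#
    enumeration : Carrier ↔ Fin q

  _^_ : Carrier → ℕ → Carrier
  x ^ zero = 1#
  x ^ suc n = x * (x ^ n)

  private
    module E = Inverse enumeration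
  toF : Carrier → Fin q
  toF = E.to
  fromF : Fin q → Carrier
  fromF = E.from

  -- |{ g x : x ∈ GF(q) }| : the number of elements of the field hit by g
  imageSize : (Carrier → Carrier) → ℕ
  imageSize g =
    length (filter (λ j → any? (λ i → toF (g (fromF i)) ≟ᶠ j)) (allFin q))

  IsPermutation : (Carrier → Carrier) → Set
  IsPermutation f = Bijective _≡_ _≡_ f

  IsDPolynomial : (Carrier → Carrier) → Set
  IsDPolynomial f =
    IsPermutation f
    × (∀ b b′ → b ≢ 0# → b′ ≢ 0# →
         imageSize (λ x → f x + b * x) ≡ imageSize (λ x → f x + b′ * x))

module Submission where

-- Let F be a finite field with q = N + 1 elements and let e = k + 1 with
-- gcd(e, N) = gcd(k, N) = 1 (both follow from gcd(e(e-1), q-1) = 1).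
--
--  * Fermat's little theorem gives a^N = 1 for a ≠ 0, so by Bézout every
--    exponent k coprime to N has an inverse exponent x with a^(x k) = a;
--    hence a ↦ a^k is a bijection of F \ {0}.  With k = e this makes
--    f(x) = x^e a permutation of F.
--  * For b ≠ 0 choose c ≠ 0 with c^(e-1) = b.  Then
--        f(c y) + b (c y) = c^e (f(y) + y),
--    i.e. x ↦ f(x) + b x is y ↦ f(y) + y up to the bijections y ↦ c y and
--    z ↦ c^e z.  Image sizes are invariant under such a change of variables,
--    so |{f(x) + b x}| = |{f(y) + y}| does not depend on b.

open import Defs
open import Data.Nat using (ℕ; _*_; _∸_; _^_; _≤_)
open import Data.Nat.GCD using (gcd)
open import Relation.Binary.PropositionalEquality using (_≡_)

open import Level using (0ℓ)
open import Data.Nat using (zero; suc)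
import Data.Nat.Properties as ℕ
open import Data.Nat.GCD using (module Bézout)
open import Data.Nat.Coprimality using (Coprime; gcd≡1⇒coprime; coprime-Bézout)
open import Data.Nat.Divisibility using (_∣_; ∣-trans; m∣m*n; n∣m*n)
import Data.Fin as Fin
open import Data.Fin using (Fin; punchIn)
open import Data.Fin.Properties using (any?; punchInᵢ≢i; inj⇒≟) renaming (_≟_ to _≟ᶠ_)
open import Data.Fin.Permutation using (Permutation′; _⟨$⟩ʳ_)
open import Data.List using (filter; length; allFin; tabulate)
open import Data.List.Properties using (filter-≐)
open import Data.Vec.Functional using (Vector)
open import Data.Product using (∃; _,_; _×_; proj₁; proj₂)
open import Data.Empty using (⊥-elim)
open import Relation.Nullary using (Dec; yes; no)
open import Relation.Unary using (Pred; Decidable; _≐_)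
open import Relation.Binary.PropositionalEquality
  using (refl; sym; trans; cong; cong₂; subst; _≢_; module ≡-Reasoning)
open import Function.Base using (_∘_; id)
open import Function.Bundles using (Inverse; _↔_; mk↔ₛ′)
open import Function.Properties.Inverse using (↔-sym; ↔-trans; ↔⇒↣)
open import Algebra.Bundles using (CommutativeRing)
import Algebra.Properties.CommutativeMonoid.Sum as MonoidSum
import Algebra.Properties.CommutativeSemiring.Exp as SemiringExp

open ≡-Reasoning

coprime-∣ : ∀ {d a n} → d ∣ a → Coprime a n → Coprime d n
coprime-∣ d∣a a⊥n (i∣d , i∣n) = a⊥n (∣-trans i∣d d∣a , i∣n)

indicator : ∀ {p} {P : Set p} → Dec P → ℕ
indicator (yes _) = 1
indicator (no _)  = 0

module NatSum = MonoidSum ℕ.+-0-commutativeMonoid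

count : ∀ {n p} {P : Pred (Fin n) p} → Decidable P → ℕ
count {n} P? = length (filter P? (allFin n))

length-filter-tabulate : ∀ {a p} {A : Set a} {P : Pred A p} (P? : Decidable P) {n} (f : Fin n → A) →
  length (filter P? (tabulate f)) ≡ NatSum.sum (λ i → indicator (P? (f i)))
length-filter-tabulate P? {zero} f = refl
length-filter-tabulate P? {suc n} f with P? (f Fin.zero)
... | yes _ = cong suc (length-filter-tabulate P? (f ∘ Fin.suc))
... | no _  = length-filter-tabulate P? (f ∘ Fin.suc)

count-cong : ∀ {n p r} {P : Pred (Fin n) p} {Q : Pred (Fin n) r} (P? : Decidable P) (Q? : Decidable Q) →
  P ≐ Q → count P? ≡ count Q?
count-cong {n} P? Q? P≐Q = cong length (filter-≐ P? Q? P≐Q (allFin n))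

count-permute : ∀ {n p} {P : Pred (Fin n) p} (P? : Decidable P) (π : Permutation′ n) →
  count (λ i → P? (π ⟨$⟩ʳ i)) ≡ count P?
count-permute P? π = begin
  count (λ i → P? (π ⟨$⟩ʳ i))               ≡⟨ length-filter-tabulate (λ i → P? (π ⟨$⟩ʳ i)) id ⟩
  NatSum.sum (λ i → indicator (P? (π ⟨$⟩ʳ i))) ≡⟨ NatSum.sum-permute (λ i → indicator (P? i)) π ⟨
  NatSum.sum (λ i → indicator (P? i))         ≡⟨ length-filter-tabulate P? id ⟨
  count P?                                    ∎

conjugate : ∀ {A : Set} {n} → A ↔ Fin n → A ↔ A → Permutation′ n
conjugate ι σ = ↔-trans (↔-sym ι) (↔-trans σ ι)

module FieldTheory {q : ℕ} (F : FiniteField q) where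
  open FiniteField F renaming (_+_ to _+ᶠ_; _*_ to _·_; _^_ to _^ᶠ_)

  ring : CommutativeRing 0ℓ 0ℓ
  ring = record
    { Carrier = Carrier ; _≈_ = _≡_ ; _+_ = _+ᶠ_ ; _*_ = _·_ ; -_ = -_
    ; 0# = 0# ; 1# = 1# ; isCommutativeRing = isCommutativeRing }

  open CommutativeRing ring
    using (*-assoc; *-comm; *-identityˡ; *-identityʳ; zeroˡ; zeroʳ; distribˡ;
           *-commutativeMonoid; commutativeSemiring)
  open SemiringExp commutativeSemiring using (^-assocʳ; ^-distrib-*) renaming (_^_ to _^ˢ_)

  module Product = MonoidSum *-commutativeMonoid

  ∏ : ∀ {n} → Vector Carrier n → Carrier
  ∏ = Product.sum

  module Enum = Inverse enumeration

  infix 4 _≟_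
  _≟_ : (x y : Carrier) → Dec (x ≡ y)
  _≟_ = inj⇒≟ (↔⇒↣ enumeration)

  ·-cancelʳ : ∀ {t} x y → t ≢ 0# → x · t ≡ y · t → x ≡ y
  ·-cancelʳ {t} x y t≢0 xt≡yt with hasInverse t t≢0
  ... | s , ts≡1 = begin
    x             ≡⟨ *-identityʳ x ⟨
    x · 1#        ≡⟨ cong (x ·_) ts≡1 ⟨
    x · (t · s)   ≡⟨ *-assoc x t s ⟨
    (x · t) · s   ≡⟨ cong (_· s) xt≡yt ⟩
    (y · t) · s   ≡⟨ *-assoc y t s ⟩
    y · (t · s)   ≡⟨ cong (y ·_) ts≡1 ⟩
    y · 1#        ≡⟨ *-identityʳ y ⟩
    y             ∎

  ·-nonzero : ∀ {x y} → x ≢ 0# → y ≢ 0# → x · y ≢ 0#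
  ·-nonzero {x} {y} x≢0 y≢0 xy≡0 =
    y≢0 (·-cancelʳ y 0# x≢0 (trans (*-comm y x) (trans xy≡0 (sym (zeroˡ x)))))

  ^-nonzero : ∀ {x} → x ≢ 0# → ∀ n → x ^ᶠ n ≢ 0#
  ^-nonzero x≢0 zero    = 0≢1 ∘ sym
  ^-nonzero x≢0 (suc n) = ·-nonzero x≢0 (^-nonzero x≢0 n)

  ∏-nonzero : ∀ {n} (v : Vector Carrier n) → (∀ i → v i ≢ 0#) → ∏ v ≢ 0#
  ∏-nonzero {zero} v _ = 0≢1 ∘ sym
  ∏-nonzero {suc n} v v≢0 = ·-nonzero (v≢0 Fin.zero) (∏-nonzero (v ∘ Fin.suc) (v≢0 ∘ Fin.suc))

  -- The record's power is the library's semiring exponentiation, so the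
  -- library's exponent laws apply to it.
  ^ᶠ≡^ˢ : ∀ x n → x ^ᶠ n ≡ x ^ˢ n
  ^ᶠ≡^ˢ x zero    = refl
  ^ᶠ≡^ˢ x (suc n) = cong (x ·_) (^ᶠ≡^ˢ x n)

  ^-* : ∀ x m n → (x ^ᶠ m) ^ᶠ n ≡ x ^ᶠ (m * n)
  ^-* x m n = begin
    (x ^ᶠ m) ^ᶠ n   ≡⟨ ^ᶠ≡^ˢ (x ^ᶠ m) n ⟩
    (x ^ᶠ m) ^ˢ n   ≡⟨ cong (_^ˢ n) (^ᶠ≡^ˢ x m) ⟩
    (x ^ˢ m) ^ˢ n   ≡⟨ ^-assocʳ x m n ⟩
    x ^ˢ (m * n)    ≡⟨ ^ᶠ≡^ˢ x (m * n) ⟨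
    x ^ᶠ (m * n)    ∎

  ^-distrib : ∀ x y n → (x · y) ^ᶠ n ≡ x ^ᶠ n · y ^ᶠ n
  ^-distrib x y n = begin
    (x · y) ^ᶠ n        ≡⟨ ^ᶠ≡^ˢ (x · y) n ⟩
    (x · y) ^ˢ n        ≡⟨ ^-distrib-* x y n ⟩
    x ^ˢ n · y ^ˢ n     ≡⟨ cong₂ _·_ (^ᶠ≡^ˢ x n) (^ᶠ≡^ˢ y n) ⟨
    x ^ᶠ n · y ^ᶠ n     ∎

  1^n≡1 : ∀ n → 1# ^ᶠ n ≡ 1#
  1^n≡1 zero    = refl
  1^n≡1 (suc n) = trans (*-identityˡ _) (1^n≡1 n)

  inverse-power : ∀ {a} d → a ≢ 0# → a · a ^ᶠ d ≡ 1# → a ^ᶠ (d * d) ≡ a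
  inverse-power {a} d a≢0 a·a^d≡1 = begin
    a ^ᶠ (d * d)    ≡⟨ ^-* a d d ⟨
    (a ^ᶠ d) ^ᶠ d   ≡⟨ ·-cancelʳ _ a (^-nonzero a≢0 d) cancelled ⟩
    a               ∎
    where
    cancelled : (a ^ᶠ d) ^ᶠ d · a ^ᶠ d ≡ a · a ^ᶠ d
    cancelled = begin
      (a ^ᶠ d) ^ᶠ d · a ^ᶠ d  ≡⟨ *-comm _ _ ⟩
      a ^ᶠ d · (a ^ᶠ d) ^ᶠ d  ≡⟨ ^-distrib a (a ^ᶠ d) d ⟨
      (a · a ^ᶠ d) ^ᶠ d       ≡⟨ cong (_^ᶠ d) a·a^d≡1 ⟩
      1# ^ᶠ d                 ≡⟨ 1^n≡1 d ⟩
      1#                      ≡⟨ a·a^d≡1 ⟨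
      a · a ^ᶠ d              ∎

  scaling : ∀ t → t ≢ 0# → Carrier ↔ Carrier
  scaling t t≢0 = mk↔ₛ′ (t ·_) (s ·_) (undo ts≡1) (undo (trans (*-comm s t) ts≡1))
    where
    s : Carrier
    s = proj₁ (hasInverse t t≢0)
    ts≡1 : t · s ≡ 1#
    ts≡1 = proj₂ (hasInverse t t≢0)
    undo : ∀ {u v} → u · v ≡ 1# → ∀ z → u · (v · z) ≡ z
    undo {u} {v} uv≡1 z = trans (sym (*-assoc u v z)) (trans (cong (_· z) uv≡1) (*-identityˡ z))

  -- unitPart x replaces 0 by 1; scaleOn a x is the factor by which it
  -- changes when x is multiplied by a (1 at x = 0, a elsewhere).
  unitPart : Carrier → Carrier
  unitPart x with x ≟ 0#
  ... | yes _ = 1#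
  ... | no _  = x

  scaleOn : Carrier → Carrier → Carrier
  scaleOn a x with x ≟ 0#
  ... | yes _ = 1#
  ... | no _  = a

  unitPart-nonzero : ∀ x → unitPart x ≢ 0#
  unitPart-nonzero x with x ≟ 0#
  ... | yes _   = 0≢1 ∘ sym
  ... | no x≢0  = x≢0

  unitPart-· : ∀ {a} → a ≢ 0# → ∀ x → unitPart (a · x) ≡ scaleOn a x · unitPart x
  unitPart-· {a} a≢0 x with x ≟ 0# | a · x ≟ 0#
  ... | yes _   | yes _    = sym (*-identityˡ 1#)
  ... | yes x≡0 | no ax≢0  = ⊥-elim (ax≢0 (trans (cong (a ·_) x≡0) (zeroʳ a)))
  ... | no x≢0  | yes ax≡0 = ⊥-elim (·-nonzero a≢0 x≢0 ax≡0)
  ... | no _    | no _     = refl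

  scaleOn-zero : ∀ a → scaleOn a 0# ≡ 1#
  scaleOn-zero a with 0# ≟ 0#
  ... | yes _  = refl
  ... | no 0≢0 = ⊥-elim (0≢0 refl)

  scaleOn-nonzero : ∀ a {x} → x ≢ 0# → scaleOn a x ≡ a
  scaleOn-nonzero a {x} x≢0 with x ≟ 0#
  ... | yes x≡0 = ⊥-elim (x≢0 x≡0)
  ... | no _    = refl

  ∏-bijection : ∀ {n} (ι : Carrier ↔ Fin n) (σ : Carrier ↔ Carrier) (g : Carrier → Carrier) →
    ∏ (λ i → g (Inverse.to σ (Inverse.from ι i))) ≡ ∏ (λ i → g (Inverse.from ι i))
  ∏-bijection {n} ι σ g = begin
    ∏ {n} (λ i → g (σ.to (ι.from i)))                  ≡⟨ Product.sum-cong-≗ (λ i → cong g (ι.strictlyInverseʳ (σ.to (ι.from i)))) ⟨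
    ∏ {n} (λ i → g (ι.from (conjugate ι σ ⟨$⟩ʳ i)))     ≡⟨ Product.sum-permute (g ∘ ι.from) (conjugate ι σ) ⟨
    ∏ {n} (λ i → g (ι.from i))                         ∎
    where
    module ι = Inverse ι
    module σ = Inverse σ

  -- Fermat's little theorem: in a field with N + 1 elements, a^N = 1 for a ≠ 0.
  -- Compare ∏ unitPart(x) with ∏ unitPart(a x) over all x.
  fermat : ∀ {N} → Carrier ↔ Fin (suc N) → ∀ a → a ≢ 0# → a ^ᶠ N ≡ 1#
  fermat {N} ι a a≢0 = ·-cancelʳ (a ^ᶠ N) 1# (∏-nonzero U (unitPart-nonzero ∘ ι.from)) (begin
    a ^ᶠ N · ∏ U                       ≡⟨ cong (_· ∏ U) ∏S≡a^N ⟨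
    ∏ S · ∏ U                          ≡⟨ Product.∑-distrib-+ S U ⟨
    ∏ (λ i → S i · U i)                ≡⟨ Product.sum-cong-≗ (unitPart-· a≢0 ∘ ι.from) ⟨
    ∏ (λ i → unitPart (a · ι.from i))  ≡⟨ ∏-bijection ι (scaling a a≢0) unitPart ⟩
    ∏ U                                ≡⟨ *-identityˡ (∏ U) ⟨
    1# · ∏ U                           ∎)
    where
    module ι = Inverse ι
    U S : Vector Carrier (suc N)
    U i = unitPart (ι.from i)
    S i = scaleOn a (ι.from i)
    i₀ : Fin (suc N)
    i₀ = ι.to 0#
    -- only the index of 0 contributes 1 to ∏ S; the other N indices contribute a
    ∏S≡a^N : ∏ S ≡ a ^ᶠ N
    ∏S≡a^N = begin
      ∏ S                              ≡⟨ Product.sum-remove {i = i₀} S ⟩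
      S i₀ · ∏ (S ∘ punchIn i₀)        ≡⟨ cong₂ _·_ (trans (cong (scaleOn a) (ι.strictlyInverseʳ 0#)) (scaleOn-zero a))
                                                   (Product.sum-cong-≗ (λ j → scaleOn-nonzero a (punchIn≢0 j))) ⟩
      1# · ∏ {N} (λ _ → a)              ≡⟨ *-identityˡ _ ⟩
      ∏ {N} (λ _ → a)                   ≡⟨ Product.sum-replicate N ⟩
      a ^ˢ N                           ≡⟨ ^ᶠ≡^ˢ a N ⟨
      a ^ᶠ N                           ∎
      where
      punchIn≢0 : ∀ j → ι.from (punchIn i₀ j) ≢ 0#
      punchIn≢0 j eq = punchInᵢ≢i i₀ j (trans (sym (ι.strictlyInverseˡ _)) (cong ι.to eq))

  module PowerMaps {N} (a^N≡1 : ∀ a → a ≢ 0# → a ^ᶠ N ≡ 1#) where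

    ^-multiple : ∀ a → a ≢ 0# → ∀ y → a ^ᶠ (y * N) ≡ 1#
    ^-multiple a a≢0 y = begin
      a ^ᶠ (y * N)   ≡⟨ cong (a ^ᶠ_) (ℕ.*-comm y N) ⟩
      a ^ᶠ (N * y)   ≡⟨ ^-* a N y ⟨
      (a ^ᶠ N) ^ᶠ y  ≡⟨ cong (_^ᶠ y) (a^N≡1 a a≢0) ⟩
      1# ^ᶠ y        ≡⟨ 1^n≡1 y ⟩
      1#             ∎

    -- From Bézout, either x k = 1 + y N, or x k + 1 = y N and then the
    -- exponent (x k) x works since a^(x k) is the inverse of a.
    inverseExponent : ∀ k → Coprime k N → ∃ λ x → ∀ a → a ≢ 0# → a ^ᶠ (x * k) ≡ a
    inverseExponent k k⊥N with coprime-Bézout k⊥N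
    ... | Bézout.+- x y 1+yN≡xk = x , λ a a≢0 → begin
      a ^ᶠ (x * k)      ≡⟨ cong (a ^ᶠ_) 1+yN≡xk ⟨
      a · a ^ᶠ (y * N)  ≡⟨ cong (a ·_) (^-multiple a a≢0 y) ⟩
      a · 1#            ≡⟨ *-identityʳ a ⟩
      a                 ∎
    ... | Bézout.-+ x y 1+xk≡yN = x * k * x , λ a a≢0 → begin
      a ^ᶠ (x * k * x * k)      ≡⟨ cong (a ^ᶠ_) (ℕ.*-assoc (x * k) x k) ⟩
      a ^ᶠ (x * k * (x * k))    ≡⟨ inverse-power (x * k) a≢0 (trans (cong (a ^ᶠ_) 1+xk≡yN) (^-multiple a a≢0 y)) ⟩
      a                         ∎

    root : ∀ k → Coprime k N → ∀ b → b ≢ 0# → ∃ λ c → c ≢ 0# × c ^ᶠ k ≡ b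
    root k k⊥N b b≢0 with inverseExponent k k⊥N
    ... | x , inv = b ^ᶠ x , ^-nonzero b≢0 x , trans (^-* b x k) (inv b b≢0)

    ^-injective : ∀ k → Coprime k N → ∀ {z w} → z ≢ 0# → w ≢ 0# → z ^ᶠ k ≡ w ^ᶠ k → z ≡ w
    ^-injective k k⊥N {z} {w} z≢0 w≢0 z^k≡w^k with inverseExponent k k⊥N
    ... | x , inv = begin
      z                ≡⟨ undo z z≢0 ⟨
      (z ^ᶠ k) ^ᶠ x    ≡⟨ cong (_^ᶠ x) z^k≡w^k ⟩
      (w ^ᶠ k) ^ᶠ x    ≡⟨ undo w w≢0 ⟩
      w                ∎
      where
      undo : ∀ a → a ≢ 0# → (a ^ᶠ k) ^ᶠ x ≡ a
      undo a a≢0 = trans (^-* a k x) (trans (cong (a ^ᶠ_) (ℕ.*-comm k x)) (inv a a≢0))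

    -- For e coprime to N (and e ≥ 1, so that 0 ↦ 0), x ↦ x^e permutes the field.
    power-isPermutation : ∀ k → Coprime (suc k) N → IsPermutation (_^ᶠ suc k)
    power-isPermutation k e⊥N = injective , surjective
      where
      injective : ∀ {x y} → x ^ᶠ suc k ≡ y ^ᶠ suc k → x ≡ y
      injective {x} {y} eq with x ≟ 0# | y ≟ 0#
      ... | yes refl | yes refl = refl
      ... | yes refl | no y≢0   = ⊥-elim (^-nonzero y≢0 (suc k) (trans (sym eq) (zeroˡ _)))
      ... | no x≢0   | yes refl = ⊥-elim (^-nonzero x≢0 (suc k) (trans eq (zeroˡ _)))
      ... | no x≢0   | no y≢0   = ^-injective (suc k) e⊥N x≢0 y≢0 eq
      surjective : ∀ y → ∃ λ x → ∀ {z} → z ≡ x → z ^ᶠ suc k ≡ y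
      surjective y with y ≟ 0#
      ... | yes refl = 0# , λ { refl → zeroˡ _ }
      ... | no y≢0   = let (c , _ , c^e≡y) = root (suc k) e⊥N y y≢0 in c , λ { refl → c^e≡y }

  -- Image g z: z is a value of g.  Hits g j is the predicate counted by
  -- imageSize g, so imageSize g is definitionally count (hits? g).
  Image : (Carrier → Carrier) → Pred Carrier 0ℓ
  Image g z = ∃ λ x → g x ≡ z

  Hits : (Carrier → Carrier) → Pred (Fin q) 0ℓ
  Hits g j = ∃ λ i → toF (g (fromF i)) ≡ j

  hits? : ∀ g → Decidable (Hits g)
  hits? g j = any? (λ i → toF (g (fromF i)) ≟ᶠ j)

  hits⇒image : ∀ {g j} → Hits g j → Image g (fromF j)
  hits⇒image {g} (i , toF[g]≡j) = fromF i , trans (sym (Enum.strictlyInverseʳ _)) (cong fromF toF[g]≡j)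

  image⇒hits : ∀ {g z} → Image g z → Hits g (toF z)
  image⇒hits {g} (x , gx≡z) = toF x , trans (cong (λ y → toF (g y)) (Enum.strictlyInverseʳ x)) (cong toF gx≡z)

  imageSize-cong : ∀ g h → (∀ {z} → Image g z → Image h z) → (∀ {z} → Image h z → Image g z) →
    imageSize g ≡ imageSize h
  imageSize-cong g h g⊆h h⊆g = count-cong (hits? g) (hits? h) (transfer g⊆h , transfer h⊆g)
    where
    transfer : ∀ {g h} → (∀ {z} → Image g z → Image h z) → ∀ {j} → Hits g j → Hits h j
    transfer {h = h} g⊆h {j} hit = subst (Hits h) (Enum.strictlyInverseˡ j) (image⇒hits (g⊆h (hits⇒image hit)))

  imageSize-bijection : ∀ (σ : Carrier ↔ Carrier) g → imageSize (Inverse.to σ ∘ g) ≡ imageSize g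
  imageSize-bijection σ g = begin
    imageSize (σ.to ∘ g)               ≡⟨ count-cong (hits? (σ.to ∘ g)) (λ j → hits? g (π ⟨$⟩ʳ j)) (pull , push) ⟩
    count (λ j → hits? g (π ⟨$⟩ʳ j))   ≡⟨ count-permute (hits? g) π ⟩
    imageSize g                        ∎
    where
    module σ = Inverse σ
    π : Permutation′ q
    π = conjugate enumeration (↔-sym σ)
    pull : ∀ {j} → Hits (σ.to ∘ g) j → Hits g (π ⟨$⟩ʳ j)
    pull hit = let (x , σgx≡z) = hits⇒image {σ.to ∘ g} hit
               in image⇒hits {g} (x , trans (sym (σ.strictlyInverseʳ (g x))) (cong σ.from σgx≡z))
    push : ∀ {j} → Hits g (π ⟨$⟩ʳ j) → Hits (σ.to ∘ g) j
    push {j} hit = let (x , gx≡z) = hits⇒image {g} hit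
                   in subst (Hits (σ.to ∘ g)) (Enum.strictlyInverseˡ j)
                        (image⇒hits {σ.to ∘ g} (x , trans (cong σ.to (trans gx≡z (Enum.strictlyInverseʳ _))) (σ.strictlyInverseˡ _)))

  imageSize-conjugate : ∀ (τ σ : Carrier ↔ Carrier) h g → (∀ y → h (Inverse.to τ y) ≡ Inverse.to σ (g y)) →
    imageSize h ≡ imageSize g
  imageSize-conjugate τ σ h g h∘τ≡σ∘g = begin
    imageSize h             ≡⟨ imageSize-cong h (σ.to ∘ g) h⊆σg σg⊆h ⟩
    imageSize (σ.to ∘ g)    ≡⟨ imageSize-bijection σ g ⟩
    imageSize g             ∎
    where
    module τ = Inverse τ
    module σ = Inverse σ
    h⊆σg : ∀ {z} → Image h z → Image (σ.to ∘ g) z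
    h⊆σg (x , hx≡z) = τ.from x , trans (sym (h∘τ≡σ∘g (τ.from x))) (trans (cong h (τ.strictlyInverseˡ x)) hx≡z)
    σg⊆h : ∀ {z} → Image (σ.to ∘ g) z → Image h z
    σg⊆h (y , σgy≡z) = τ.to y , trans (h∘τ≡σ∘g y) σgy≡z

  shift-by-power : ∀ k {b c} → c ≢ 0# → c ^ᶠ k ≡ b →
    imageSize (λ x → x ^ᶠ suc k +ᶠ b · x) ≡ imageSize (λ y → y ^ᶠ suc k +ᶠ y)
  shift-by-power k {b} {c} c≢0 c^k≡b =
    imageSize-conjugate (scaling c c≢0) (scaling (f c) (^-nonzero c≢0 (suc k)))
      (λ x → f x +ᶠ b · x) (λ y → f y +ᶠ y) rescale
    where
    f : Carrier → Carrier
    f x = x ^ᶠ suc k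
    rescale : ∀ y → f (c · y) +ᶠ b · (c · y) ≡ f c · (f y +ᶠ y)
    rescale y = begin
      f (c · y) +ᶠ b · (c · y)    ≡⟨ cong₂ _+ᶠ_ (^-distrib c y (suc k)) (sym (*-assoc b c y)) ⟩
      f c · f y +ᶠ (b · c) · y    ≡⟨ cong (λ u → f c · f y +ᶠ u · y) (trans (*-comm b c) (cong (c ·_) (sym c^k≡b))) ⟩
      f c · f y +ᶠ f c · y        ≡⟨ distribˡ (f c) (f y) y ⟨
      f c · (f y +ᶠ y)            ∎

  -- The theorem for an arbitrary finite field with N + 1 elements and
  -- exponent e = k + 1 with gcd(e, N) = gcd(k, N) = 1: every b ≠ 0 is a
  -- k-th power, so every image size equals the one for b = 1.
  power-isDPolynomial : ∀ {N} → q ≡ suc N → ∀ k → Coprime (suc k) N → Coprime k N →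
    IsDPolynomial (_^ᶠ suc k)
  power-isDPolynomial {N} q≡1+N k e⊥N k⊥N =
    power-isPermutation k e⊥N , λ b b′ b≢0 b′≢0 → trans (size≡size₁ b b≢0) (sym (size≡size₁ b′ b′≢0))
    where
    open PowerMaps {N} (fermat (subst (λ n → Carrier ↔ Fin n) q≡1+N enumeration))
    size≡size₁ : ∀ b → b ≢ 0# →
      imageSize (λ x → x ^ᶠ suc k +ᶠ b · x) ≡ imageSize (λ y → y ^ᶠ suc k +ᶠ y)
    size≡size₁ b b≢0 = let (_ , c≢0 , c^k≡b) = root k k⊥N b b≢0 in shift-by-power k c≢0 c^k≡b

mainTheorem6 : (m : ℕ) → 1 ≤ m → (F : FiniteField (2 ^ m)) → (e : ℕ) → 1 ≤ e
    → gcd (e * (e ∸ 1)) (2 ^ m ∸ 1) ≡ 1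
    → FiniteField.IsDPolynomial F (λ x → FiniteField._^_ F x e)
mainTheorem6 m _ F zero () _
mainTheorem6 m _ F (suc k) _ gcd≡1 =
  FieldTheory.power-isDPolynomial F q≡1+N k (coprime-∣ (m∣m*n k) e[e-1]⊥N) (coprime-∣ (n∣m*n (suc k)) e[e-1]⊥N)
  where
  N : ℕ
  N = 2 ^ m ∸ 1
  q≡1+N : 2 ^ m ≡ suc N
  q≡1+N = sym (ℕ.suc-pred (2 ^ m) {{ℕ.m^n≢0 2 m}})
  e[e-1]⊥N : Coprime (suc k * k) N
  e[e-1]⊥N = gcd≡1⇒coprime {suc k * k} {N} gcd≡1
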